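{- Let $X$ be a set. For any two paths $p_1,p_2\in\mathrm{Path}(X)$, if $\mathrm{st}(p_1)\preceq\mathrm{st}(p_2)$ then there exists $p\in\mathrm{Path}(X)$ with $p\sim p_1$ and $p\preceq p_2$.
   Context: Fix a set $A$, $\tau\notin A$, $A_\tau=A\cup\{\tau\}$, $A_\tau^*$ the finite words, $\epsilon$ the empty word, ${\downarrow}\sigma$ the set of prefixes of $\sigma$. A path on $X$ is a function $p$ into $X$ with domain ${\downarrow}\sigma$ for some $\sigma\in A_\tau^*$; $\mathrm{Path}(X)$ is the set of paths, ordered by $p\preceq q$ iff $\mathrm{dom}\,p\subseteq\mathrm{dom}\,q$ and $q(\sigma)=p(\sigma)$ for all $\sigma\in\mathrm{dom}\,p$. The stutter basis of $p$ is the unique $\phi:\mathrm{dom}\,p\to A_\tau^*$ with $\phi(\epsilon)=\epsilon$; $\phi(\sigma'\tau)=\phi(\sigma')$ if $p(\sigma'\tau)=p(\sigma')$; $\phi(\sigma'\tau)=\phi(\sigma')\tau$ if $p(\sigma'\tau)\ne p(\sigma')$; $\phi(\sigma'a)=\phi(\sigma')a$ for $a\in A$. $\mathrm{st}(p)$ is the path with domain $\phi(\mathrm{dom}\,p)$ such that $\mathrm{st}(p)\circ\phi=p$; $p\sim q$ iff $\mathrm{st}(p)=\mathrm{st}(q)$. -}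

module Defs where

open import Data.List using (List; []; _∷_)
open import Data.Product using (Σ; _×_; _,_)
open import Relation.Binary.PropositionalEquality using (_≡_)
open import Relation.Nullary using (¬_)

data Aτ (A : Set) : Set where
  act : A → Aτ A
  τ   : Aτ A

Word : Set → Set
Word A = List (Aτ A)

-- A path p on X with domain ↓σ, σ = c₁ c₂ … cₙ, is encoded by its value at ε
-- together with the list of steps (c₁ , p(c₁)), (c₂ , p(c₁c₂)), …, (cₙ , p(σ)).
-- This is a bijective encoding of Path(X).
record Path (A X : Set) : Set where
  constructor path
  field
    start : X
    steps : List (Aτ A × X)
open Path public

-- The graph of the path: p ∋ ρ ↦ x  iff  ρ ∈ dom p and p(ρ) = x.
data _∋_↦_ {A X : Set} : Path A X → Word A → X → Set where
  here  : ∀ {x₀ s} → path x₀ s ∋ [] ↦ x₀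
  there : ∀ {x₀ c x s ρ y} → path x s ∋ ρ ↦ y →
          path x₀ ((c , x) ∷ s) ∋ (c ∷ ρ) ↦ y

_⪯_ : {A X : Set} → Path A X → Path A X → Set
p ⪯ q = ∀ ρ x → p ∋ ρ ↦ x → q ∋ ρ ↦ x

-- IsSt p q  iff  q = st(p).  Defined by recursion along the steps of p,
-- following the stutter basis φ: a τ-step whose value equals the previous
-- value is deleted (φ(σ'τ) = φ(σ')); any other τ-step and every A-step is
-- kept (φ(σ'τ) = φ(σ')τ, φ(σ'a) = φ(σ')a).  st(p) is the path on φ(dom p)
-- with st(p) ∘ φ = p.
data IsSt {A X : Set} : Path A X → Path A X → Set where
  st-nil   : ∀ {x₀} → IsSt (path x₀ []) (path x₀ [])
  st-stut  : ∀ {x₀ s q} → IsSt (path x₀ s) q →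
             IsSt (path x₀ ((τ , x₀) ∷ s)) q
  st-τ     : ∀ {x₀ x₁ s t} → ¬ (x₁ ≡ x₀) → IsSt (path x₁ s) (path x₁ t) →
             IsSt (path x₀ ((τ , x₁) ∷ s)) (path x₀ ((τ , x₁) ∷ t))
  st-act   : ∀ {x₀ x₁ a s t} → IsSt (path x₁ s) (path x₁ t) →
             IsSt (path x₀ ((act a , x₁) ∷ s)) (path x₀ ((act a , x₁) ∷ t))

_∼_ : {A X : Set} → Path A X → Path A X → Set
_∼_ {A} {X} p q = Σ (Path A X) (λ r → IsSt p r × IsSt q r)

module Submission where

-- Stutter-reduction commutes with taking prefixes: if s is a prefix of
-- st(q), then s = st(p) for some prefix p of q.  Reading q and st(q) step by
-- step, a stutter step of q (deleted in st(q)) is copied into p, and a kept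
-- step of q must coincide with the next step of s, so it is copied as well;
-- when s is exhausted the lift stops.
--
-- Lemma 2.1 follows: for st(p₁) ⪯ st(p₂), lift st(p₁)
-- along p₂ to a prefix p of p₂ with st(p) = st(p₁), i.e. p ∼ p₁.

open import Defs
open import Data.Empty using (⊥-elim)
open import Data.List using (List; []; _∷_)
open import Data.Product using (Σ; _×_; _,_)
open import Relation.Binary.PropositionalEquality using (_≡_; refl)
open import Relation.Nullary using (¬_)

Steps : Set → Set → Set
Steps A X = List (Aτ A × X)

root-value : {A X : Set} {q : Path A X} {x : X} → q ∋ [] ↦ x → start q ≡ x
root-value here = refl

⪯-root : {A X : Set} {p q : Path A X} → p ⪯ q → start q ≡ start p
⪯-root {p = p} p⪯q = root-value (p⪯q [] (start p) here)

root-⪯ : {A X : Set} (q : Path A X) → path (start q) [] ⪯ q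
root-⪯ q .[] ._ here = here

cons-⋠-nil : {A X : Set} {y x z : X} {c : Aτ A} {t : Steps A X}
  → ¬ (path y ((c , z) ∷ t) ⪯ path x [])
cons-⋠-nil p⪯q with p⪯q (_ ∷ []) _ (there here)
... | ()

⪯-cons : {A X : Set} {y x : X} {c : Aτ A} {s t : Steps A X}
  → path x s ⪯ path x t → path y ((c , x) ∷ s) ⪯ path y ((c , x) ∷ t)
⪯-cons p⪯q .[] _ here = here
⪯-cons p⪯q (_ ∷ ρ) z (there h) = there (p⪯q ρ z h)

⪯-head : {A X : Set} {y x y' x' : X} {c c' : Aτ A} {t t' : Steps A X}
  → path y ((c , x) ∷ t) ⪯ path y' ((c' , x') ∷ t') → (c , x) ≡ (c' , x')
⪯-head p⪯q with p⪯q (_ ∷ []) _ (there here)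
... | there here = refl

⪯-tail : {A X : Set} {y x y' x' : X} {c c' : Aτ A} {t t' : Steps A X}
  → path y ((c , x) ∷ t) ⪯ path y' ((c' , x') ∷ t') → path x t ⪯ path x' t'
⪯-tail p⪯q ρ w h with p⪯q (_ ∷ ρ) w (there h)
... | there h' = h'

st-root : {A X : Set} {q s : Path A X} → IsSt q s → start s ≡ start q
st-root st-nil = refl
st-root (st-stut q↦s) = st-root q↦s
st-root (st-τ _ _) = refl
st-root (st-act _) = refl

lift-prefix : {A X : Set} {q stq : Path A X} → IsSt q stq
  → (s : Path A X) → s ⪯ stq → Σ (Path A X) (λ p → IsSt p s × p ⪯ q)
lift-prefix {q = q} q↦stq (path y []) s⪯ with ⪯-root s⪯ | st-root q↦stq
... | refl | refl = path y [] , st-nil , root-⪯ q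
lift-prefix st-nil (path y (_ ∷ _)) s⪯ = ⊥-elim (cons-⋠-nil s⪯)
lift-prefix (st-stut q↦stq) s s⪯ with lift-prefix q↦stq s s⪯
... | p , p↦s , p⪯ with ⪯-root p⪯
... | refl = path (start p) ((τ , start p) ∷ steps p) , st-stut p↦s , ⪯-cons p⪯
lift-prefix (st-τ x₁≢x₀ q↦stq) (path y (_ ∷ t)) s⪯
  with ⪯-root s⪯ | ⪯-head s⪯ | lift-prefix q↦stq (path _ t) (⪯-tail s⪯)
... | refl | refl | p , p↦s , p⪯ with ⪯-root p⪯
... | refl = path y ((τ , start p) ∷ steps p) , st-τ x₁≢x₀ p↦s , ⪯-cons p⪯
lift-prefix (st-act q↦stq) (path y (_ ∷ t)) s⪯
  with ⪯-root s⪯ | ⪯-head s⪯ | lift-prefix q↦stq (path _ t) (⪯-tail s⪯)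
... | refl | refl | p , p↦s , p⪯ with ⪯-root p⪯
... | refl = path y ((_ , start p) ∷ steps p) , st-act p↦s , ⪯-cons p⪯

lemma21 : {A X : Set} (p₁ p₂ s₁ s₂ : Path A X) →
    IsSt p₁ s₁ → IsSt p₂ s₂ → s₁ ⪯ s₂ →
    Σ (Path A X) (λ p → (p ∼ p₁) × (p ⪯ p₂))
lemma21 p₁ p₂ s₁ s₂ p₁↦s₁ p₂↦s₂ s₁⪯s₂ with lift-prefix p₂↦s₂ s₁ s₁⪯s₂
... | p , p↦s₁ , p⪯p₂ = p , (s₁ , p↦s₁ , p₁↦s₁) , p⪯p₂
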